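{- Let $G$ be a graph with $n=|V(G)|$. Let $\mathcal{I}$ be the set of all independent sets of cardinality $n$ of $G(k)$, taken over all integers $1\le k\le n$. Then $$\Gamma_{\rho}(G)=\max_{A\in\mathcal{I}}\{DMP(A)\}.$$
   Context: All graphs are finite and simple; $d_G(u,v)$ is the distance in $G$. A packing coloring $c:V(G)\to\{1,\dots,k\}$ is one in which $c(u)=c(v)=i$, $u\ne v$, implies $d_G(u,v)>i$. A greedy packing coloring is a packing coloring produced by the greedy procedure that processes the vertices in some order and assigns each vertex the smallest color $i$ such that no already-colored vertex of color $i$ is at distance at most $i$; equivalently, a packing coloring in which every vertex of color $i$ has, for each $j<i$, a vertex of color $j$ at distance at most $j$. The Grundy packing chromatic number $\Gamma_{\rho}(G)$ is the maximum number of colors used by a greedy packing coloring of $G$. For $\ell\ge 1$, $G^{\ell}$ has vertex set $\{v^{\ell}:v\in V(G)\}$ and edges $u^{\ell}v^{\ell}$ for $u\ne v$ with $d_G(u,v)\le\ell$. $G(k)$ has vertex set $\bigcup_{i=1}^k V(G^i)$ and edge set $\{v^jv^i:v\in V(G),1\le i<j\le k\}\cup\bigcup_{i=1}^kE(G^i)$. For an independent set $A$ of $G(k)$ with $|A|=n$ write $A^i=A\cap V(G^i)$, and let $H_i(A)$ be the subgraph of $G^i$ induced by the vertices $u^i$ with $u^j\notin A$ for all $j<i$. Dense maximization procedure (DMP): if $A^i$ is a maximal independent set of $H_i(A)$ for every $i\in\{1,\dots,k-1\}$, stop. Otherwise take the minimum such $i$ for which this fails; then there is $z^{\ell}\in A$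 with $\ell>i$ such that $A^i\cup\{z^i\}$ is independent in $H_i(A)$; replace $z^{\ell}$ by $z^i$ in $A$ (the result is again an independent set of size $n$) and repeat. $DMP(A)$ is the maximum, over all possible runs of this procedure (all choices made), of the largest $\ell$ such that the resulting set meets $V(G^{\ell})$. -}

module Defs where

open import Data.Nat using (ℕ; zero; suc; _≤_; _<_)
open import Data.Fin using (Fin)
open import Data.Bool using (Bool; true; false)
open import Data.Product using (Σ; ∃; _×_; _,_)
open import Data.Sum using (_⊎_)
open import Data.List using (List; length)
open import Data.List.Membership.Propositional using (_∈_)
open import Data.List.Relation.Unary.Unique.Propositional using (Unique)
open import Relation.Nullary using (¬_)
open import Relation.Binary.PropositionalEquality using (_≡_; _≢_)
open import Relation.Binary.Construct.Closure.ReflexiveTransitive using (Star)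
open import Function.Definitions using (Injective)

record Graph (n : ℕ) : Set where
  field
    Adj    : Fin n → Fin n → Bool
    sym    : ∀ u v → Adj u v ≡ Adj v u
    irrefl : ∀ v → Adj v v ≡ false
open Graph public

data Walk {n : ℕ} (G : Graph n) : Fin n → Fin n → ℕ → Set where
  here : ∀ {v} → Walk G v v 0
  step : ∀ {u w v m} → Adj G u w ≡ true → Walk G w v m → Walk G u v (suc m)

-- d_G(u,v) ≤ i  (so d_G(u,v) > i is ¬ DistLe G i u v; disconnected = ∞)
DistLe : {n : ℕ} → Graph n → ℕ → Fin n → Fin n → Set
DistLe G i u v = ∃ λ m → m ≤ i × Walk G u v m

-- c is the output of the greedy procedure processing the vertices in the
-- order given by the injective position map pos (pos u < pos v: u first):
-- each vertex gets the least colour i ≥ 1 with no earlier vertex of colour i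
-- at distance ≤ i.
IsGreedyPacking : {n : ℕ} → Graph n → (Fin n → ℕ) → Set
IsGreedyPacking {n} G c =
  Σ (Fin n → Fin n) λ pos → Injective _≡_ _≡_ pos ×
    (∀ v → 1 ≤ c v
         × (∀ u → Data.Fin._<_ (pos u) (pos v) → c u ≡ c v → ¬ DistLe G (c v) u v)
         × (∀ j → 1 ≤ j → j < c v →
              ∃ λ u → Data.Fin._<_ (pos u) (pos v) × c u ≡ j × DistLe G j u v))

UsesColors : {n : ℕ} → (Fin n → ℕ) → ℕ → Set
UsesColors c m = (∀ v → 1 ≤ c v × c v ≤ m) × (∀ j → 1 ≤ j → j ≤ m → ∃ λ v → c v ≡ j)

GreedyCount : {n : ℕ} → Graph n → ℕ → Set
GreedyCount G m = ∃ λ c → IsGreedyPacking G c × UsesColors c m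

IsMax : (ℕ → Set) → ℕ → Set
IsMax P m = P m × (∀ m' → P m' → m' ≤ m)

-- G(k) and its vertex subsets.  Vertex v^i of G(k) is the pair (v , i),
-- 1 ≤ i ≤ k.  A vertex subset is a duplicate-free list of such pairs.

VSet : ℕ → Set
VSet n = List (Fin n × ℕ)

AdjGk : {n : ℕ} → Graph n → Fin n × ℕ → Fin n × ℕ → Set
AdjGk G (u , i) (v , j) = (u ≡ v × i ≢ j) ⊎ (i ≡ j × u ≢ v × DistLe G i u v)

IndepOfSizeN : {n : ℕ} → Graph n → ℕ → VSet n → Set
IndepOfSizeN {n} G k A =
  Unique A × length A ≡ n
  × (∀ {v i} → (v , i) ∈ A → 1 ≤ i × i ≤ k)
  × (∀ {p q} → p ∈ A → q ∈ A → p ≢ q → ¬ AdjGk G p q)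

InH : {n : ℕ} → VSet n → ℕ → Fin n → Set
InH A i u = ∀ j → 1 ≤ j → j < i → ¬ ((u , j) ∈ A)

MaximalAt : {n : ℕ} → Graph n → VSet n → ℕ → Set
MaximalAt G A i =
  (∀ u → (u , i) ∈ A → InH A i u)
  × (∀ u v → (u , i) ∈ A → (v , i) ∈ A → u ≢ v → ¬ DistLe G i u v)
  × (∀ w → InH A i w → ¬ ((w , i) ∈ A) →
       ∃ λ u → (u , i) ∈ A × u ≢ w × DistLe G i u w)

DMPStop : {n : ℕ} → Graph n → ℕ → VSet n → Set
DMPStop G k A = ∀ i → 1 ≤ i → i < k → MaximalAt G A i

-- one step of DMP: i is the minimal failing index in {1,…,k-1};
-- z^ℓ ∈ A, ℓ > i, A^i ∪ {z^i} independent in H_i(A); A' = A - z^ℓ + z^i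
DMPStep : {n : ℕ} → Graph n → ℕ → VSet n → VSet n → Set
DMPStep {n} G k A A' =
  Σ ℕ λ i → 1 ≤ i × i < k
  × (∀ j → 1 ≤ j → j < i → MaximalAt G A j)
  × ¬ MaximalAt G A i
  × Σ (Fin n) λ z → Σ ℕ λ ℓ → (z , ℓ) ∈ A × i < ℓ
  × InH A i z × ¬ ((z , i) ∈ A)
  × (∀ u → (u , i) ∈ A → u ≢ z → ¬ DistLe G i u z)
  × Unique A'
  × (∀ p → (p ∈ A' → (p ∈ A × p ≢ (z , ℓ)) ⊎ p ≡ (z , i))
         × ((p ∈ A × p ≢ (z , ℓ)) ⊎ p ≡ (z , i) → p ∈ A'))

MaxLevel : {n : ℕ} → VSet n → ℕ → Set
MaxLevel B m = (∃ λ v → (v , m) ∈ B) × (∀ {v ℓ} → (v , ℓ) ∈ B → ℓ ≤ m)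

DMPRunValue : {n : ℕ} → Graph n → ℕ → VSet n → ℕ → Set
DMPRunValue G k A m =
  ∃ λ B → Star (DMPStep G k) A B × DMPStop G k B × MaxLevel B m

DMPIs : {n : ℕ} → Graph n → ℕ → VSet n → ℕ → Set
DMPIs G k A m = IsMax (DMPRunValue G k A) m

DMPValueOnI : {n : ℕ} → Graph n → ℕ → Set
DMPValueOnI {n} G m =
  ∃ λ k → 1 ≤ k × k ≤ n × ∃ λ A → IndepOfSizeN G k A × DMPIs G k A m

{-# OPTIONS --safe #-}
-- A greedy packing colouring is the same as a packing colouring c in which every vertex of
-- colour i has, for each j < i, a vertex of colour j within distance j: given such a c, process
-- the vertices by increasing colour.  An independent n-set of G(k) contains exactly one copy
-- v^(c v) of every vertex, and its independence says that c is a packing colouring.  A DMP step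
-- z^ℓ ↦ z^i recolours z and keeps c a packing, and DMP stops exactly when the greedy condition
-- holds below colour k.  So every value DMP(A) is the number of colours of a greedy packing
-- colouring, while an optimal greedy packing colouring, read as a subset of G(Γ), is already
-- stopped with top level Γ.  The maximum Γ exists because the greedy condition is decidable,
-- Γ ≤ n, and a greedy packing colouring is reached from an injective colouring by repeatedly
-- giving some vertex a missing smaller colour, which keeps a packing and lowers the colour sum.
module Submission where

open import Defs
open import Data.Bool using (true)
import Data.Bool.Properties as Bool
open import Data.Fin as Fin using (Fin; toℕ; fromℕ<)
import Data.Fin.Properties as Fin
open import Data.Fin.Subset using (Subset; ⊤; ∣_∣) renaming (_∈_ to _∈ₛ_; _⊂_ to _⊂ₛ_)
open import Data.Fin.Subset.Properties using (∈⊤; ∣⊤∣≡n; p⊂q⇒∣p∣<∣q∣)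
open import Data.List as List using (List; length; map; allFin)
open import Data.List.Extrema.Nat using (argmax; f[xs]≤f[argmax])
open import Data.List.Membership.Propositional using (_∈_)
open import Data.List.Membership.Propositional.Properties using (∈-lookup; ∈-map⁻; ∈-map⁺; ∈-allFin)
open import Data.List.Properties using (length-map; length-tabulate)
import Data.List.Relation.Unary.All as All
import Data.List.Relation.Unary.All.Properties as All
import Data.List.Relation.Unary.Any as Any
open import Data.List.Relation.Unary.AllPairs using ([]; _∷_)
open import Data.List.Relation.Unary.Unique.Propositional using (Unique)
import Data.List.Relation.Unary.Unique.Propositional.Properties as Unique
open import Data.Nat as ℕ using (ℕ; zero; suc; _+_; _*_; _≤_; _<_; z≤n; s≤s; _≟_; _≤?_; _<?_)
open import Algebra.Definitions.RawMonoid ℕ.+-0-rawMonoid using (sum)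
open import Data.Nat.Induction using (<-wellFounded)
open import Data.Nat.Properties
open import Data.Product using (Σ; ∃; ∃₂; _×_; _,_; proj₁; proj₂; uncurry)
open import Data.Sum using (_⊎_; inj₁; inj₂)
open import Data.Vec as Vec using (Vec; []; _∷_; lookup; tabulate)
open import Data.Vec.Functional using (updateAt)
open import Data.Vec.Functional.Properties using (updateAt-updates; updateAt-minimal)
import Data.Vec.Properties as Vec
open import Function using (_∘_; _on_; id; const)
open import Function.Definitions using (Injective)
open import Induction.WellFounded using (Acc; acc)
open import Relation.Binary.Construct.On as On using ()
open import Relation.Binary.Construct.Closure.ReflexiveTransitive as Star using (Star; ε)
open import Relation.Binary.Definitions using (tri<; tri≈; tri>)
open import Relation.Binary.PropositionalEquality
  using (_≡_; _≢_; _≗_; refl; trans; cong; subst; subst₂) renaming (sym to ≡-sym)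
open import Relation.Nullary using (¬_; Dec; yes; no; contradiction)
open import Relation.Nullary.Decidable as Dec
  using (_×-dec_; _→-dec_; ¬?; dec-true; dec-false; decidable-stable)
open import Relation.Unary using (Decidable)

module _ {n : ℕ} (G : Graph n) where

  Walk-snoc : ∀ {u v w m} → Walk G u v m → Adj G v w ≡ true → Walk G u w (suc m)
  Walk-snoc here        e = step e here
  Walk-snoc (step e′ p) e = step e′ (Walk-snoc p e)

  Walk-reverse : ∀ {u v m} → Walk G u v m → Walk G v u m
  Walk-reverse here               = here
  Walk-reverse (step {u} {w} e p) = Walk-snoc (Walk-reverse p) (trans (sym G w u) e)

  DistLe-sym : ∀ {i u v} → DistLe G i u v → DistLe G i v u
  DistLe-sym (m , m≤i , p) = m , m≤i , Walk-reverse p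

  walk? : ∀ m u v → Dec (Walk G u v m)
  walk? zero    u v = Dec.map′ (λ { refl → here }) (λ { here → refl }) (u Fin.≟ v)
  walk? (suc m) u v = Dec.map′ (λ (w , e , p) → step e p) (λ { (step e p) → _ , e , p })
    (Fin.any? λ w → (Adj G u w Bool.≟ true) ×-dec walk? m w v)

  distLe? : ∀ i u v → Dec (DistLe G i u v)
  distLe? i u v = Dec.map′ (λ (m , m<1+i , p) → m , ≤-pred m<1+i , p) (λ (m , m≤i , p) → m , s≤s m≤i , p)
    (anyUpTo? (λ m → walk? m u v) (suc i))

module Ranking {n : ℕ} (key : Fin n → ℕ) where

  below : Fin n → Subset n
  below v = tabulate λ u → Dec.does (key u <? key v)

  lookup-below : ∀ u v → lookup (below v) u ≡ Dec.does (key u <? key v)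
  lookup-below u v = Vec.lookup∘tabulate _ u

  ∈-below⁺ : ∀ {u v} → key u < key v → u ∈ₛ below v
  ∈-below⁺ {u} {v} lt = Vec.lookup⇒[]= u (below v) (trans (lookup-below u v) (dec-true (key u <? key v) lt))

  ∈-below⁻ : ∀ {u v} → u ∈ₛ below v → key u < key v
  ∈-below⁻ {u} {v} u∈ = decidable-stable (key u <? key v) λ ¬lt →
    contradiction (trans (≡-sym (Vec.[]=⇒lookup u∈)) (trans (lookup-below u v) (dec-false (key u <? key v) ¬lt)))
                  λ ()

  below-⊂ : ∀ {u v} → key u < key v → below u ⊂ₛ below v
  below-⊂ {u} lt = (λ w∈ → ∈-below⁺ (<-trans (∈-below⁻ w∈) lt)) , u , ∈-below⁺ lt , λ u∈ → n≮n _ (∈-below⁻ u∈)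

  below-⊂-⊤ : ∀ v → below v ⊂ₛ ⊤
  below-⊂-⊤ v = (λ _ → ∈⊤) , v , ∈⊤ , λ v∈ → n≮n _ (∈-below⁻ v∈)

  rank : Fin n → Fin n
  rank v = fromℕ< (subst (∣ below v ∣ <_) (∣⊤∣≡n n) (p⊂q⇒∣p∣<∣q∣ (below-⊂-⊤ v)))

  rank-mono : ∀ {u v} → key u < key v → rank u Fin.< rank v
  rank-mono lt = subst₂ _<_ (≡-sym (Fin.toℕ-fromℕ< _)) (≡-sym (Fin.toℕ-fromℕ< _)) (p⊂q⇒∣p∣<∣q∣ (below-⊂ lt))

  rank-injective : Injective _≡_ _≡_ key → Injective _≡_ _≡_ rank
  rank-injective key-injective {u} {v} eq with <-cmp (key u) (key v)
  ... | tri< lt _ _ = contradiction (rank-mono lt) (Fin.<-irrefl eq)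
  ... | tri≈ _ e _  = key-injective e
  ... | tri> _ _ gt = contradiction (rank-mono gt) (Fin.<-irrefl (≡-sym eq))

colourKey : ∀ {n} → (Fin n → ℕ) → Fin n → ℕ
colourKey {n} c v = toℕ v + c v * n

colourKey-mono : ∀ {n} (c : Fin n → ℕ) {u v} → c u < c v → colourKey c u < colourKey c v
colourKey-mono {n} c {u} {v} lt = begin-strict
  toℕ u + c u * n  <⟨ +-monoˡ-< (c u * n) (Fin.toℕ<n u) ⟩
  suc (c u) * n    ≤⟨ *-monoˡ-≤ n lt ⟩
  c v * n          ≤⟨ m≤n+m (c v * n) (toℕ v) ⟩
  toℕ v + c v * n  ∎
  where open ≤-Reasoning

colourKey-injective : ∀ {n} (c : Fin n → ℕ) → Injective _≡_ _≡_ (colourKey c)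
colourKey-injective {n} c {u} {v} eq with <-cmp (c u) (c v)
... | tri< lt _ _ = contradiction eq (<⇒≢ (colourKey-mono c lt))
... | tri≈ _ e _  = Fin.toℕ-injective
  (+-cancelʳ-≡ (c v * n) (toℕ u) (toℕ v) (subst (λ x → toℕ u + x * n ≡ colourKey c v) e eq))
... | tri> _ _ gt = contradiction (≡-sym eq) (<⇒≢ (colourKey-mono c gt))

-- Greedy packing colourings without the processing order

module _ {n : ℕ} (G : Graph n) where

  IsPacking : (Fin n → ℕ) → Set
  IsPacking c = ∀ u v → u ≢ v → c u ≡ c v → ¬ DistLe G (c v) u v

  Supported : (Fin n → ℕ) → ℕ → Fin n → Set
  Supported c j v = ∃ λ u → c u ≡ j × DistLe G j u v

  IsGrundy : (Fin n → ℕ) → Set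
  IsGrundy c = ∀ v j → 1 ≤ j → j < c v → Supported c j v

  IsGrundyPacking : (Fin n → ℕ) → ℕ → Set
  IsGrundyPacking c m = UsesColors c m × IsPacking c × IsGrundy c

  GrundyPacking : ℕ → Set
  GrundyPacking m = ∃ λ c → IsGrundyPacking c m

  greedyCount⇒grundyPacking : ∀ {m} → GreedyCount G m → GrundyPacking m
  greedyCount⇒grundyPacking (c , (pos , pos-injective , greedy) , usesColors) =
    c , usesColors , packing , grundy
    where
    packing : IsPacking c
    packing u v u≢v cu≡cv d with Fin.<-cmp (pos u) (pos v)
    ... | tri< u<v _ _ = proj₁ (proj₂ (greedy v)) u u<v cu≡cv d
    ... | tri≈ _ e _   = u≢v (pos-injective e)
    ... | tri> _ _ v<u = proj₁ (proj₂ (greedy u)) v v<u (≡-sym cu≡cv)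
                           (subst (λ i → DistLe G i v u) (≡-sym cu≡cv) (DistLe-sym G d))
    grundy : IsGrundy c
    grundy v j 1≤j j<cv with proj₂ (proj₂ (greedy v)) j 1≤j j<cv
    ... | u , _ , cu≡j , d = u , cu≡j , d

  grundyPacking⇒greedyCount : ∀ {c m} → IsGrundyPacking c m → GreedyCount G m
  grundyPacking⇒greedyCount {c} (usesColors , packing , grundy) =
    c , (rank , rank-injective (colourKey-injective c) , λ v →
          proj₁ (proj₁ usesColors v)
        , (λ u ru<rv → packing u v λ { refl → Fin.<-irrefl refl ru<rv })
        , λ j 1≤j j<cv → let (u , cu≡j , d) = grundy v j 1≤j j<cv in
            u , rank-mono (colourKey-mono c (subst (_< c v) (≡-sym cu≡j) j<cv)) , cu≡j , d)
      , usesColors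
    where open Ranking (colourKey c)

usesColors⇒≤ : ∀ {n} {c : Fin n → ℕ} {m} → UsesColors c m → m ≤ n
usesColors⇒≤ {n} {c} {m} (_ , onto) = Fin.injective⇒≤ {f = vertexOf} λ {i} {j} eq →
  Fin.toℕ-injective (suc-injective (trans (≡-sym (colourOf i)) (trans (cong c eq) (colourOf j))))
  where
  vertexOf : Fin m → Fin n
  vertexOf j = proj₁ (onto (suc (toℕ j)) (s≤s z≤n) (Fin.toℕ<n j))
  colourOf : ∀ j → c (vertexOf j) ≡ suc (toℕ j)
  colourOf j = proj₂ (onto (suc (toℕ j)) (s≤s z≤n) (Fin.toℕ<n j))

anyVec? : ∀ {m} n {P : Vec (Fin m) n → Set} → Decidable P → Dec (∃ P)
anyVec? zero    P? = Dec.map′ ([] ,_) (λ { ([] , p) → p }) (P? [])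
anyVec? (suc n) P? = Dec.map′ (λ (x , xs , p) → x ∷ xs , p) (λ { (x ∷ xs , p) → x , xs , p })
  (Fin.any? λ x → anyVec? n (P? ∘ (x ∷_)))

colourIndex : ∀ {m x} → 1 ≤ x × x ≤ m → Σ (Fin m) λ i → suc (toℕ i) ≡ x
colourIndex {x = suc x} (_ , x<m) = fromℕ< x<m , cong suc (Fin.toℕ-fromℕ< x<m)

usesColors? : ∀ {n} (c : Fin n → ℕ) m → Dec (UsesColors c m)
usesColors? c m = Fin.all? (λ v → (1 ≤? c v) ×-dec (c v ≤? m))
  ×-dec Dec.map′ (λ onto j 1≤j j≤m → onto (s≤s j≤m) 1≤j) (λ onto {j} j<1+m 1≤j → onto j 1≤j (≤-pred j<1+m))
          (allUpTo? (λ j → (1 ≤? j) →-dec Fin.any? (λ v → c v ≟ j)) (suc m))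

module _ {n : ℕ} (G : Graph n) where

  isPacking? : ∀ c → Dec (IsPacking G c)
  isPacking? c = Fin.all? λ u → Fin.all? λ v →
    ¬? (u Fin.≟ v) →-dec (c u ≟ c v) →-dec ¬? (distLe? G (c v) u v)

  supported? : ∀ c j v → Dec (Supported G c j v)
  supported? c j v = Fin.any? λ u → (c u ≟ j) ×-dec distLe? G j u v

  grundy⊎unsupported : ∀ c → IsGrundy G c ⊎ ∃₂ λ v j → j < c v × 1 ≤ j × ¬ Supported G c j v
  grundy⊎unsupported c with Fin.any? (λ v → anyUpTo? (λ j → (1 ≤? j) ×-dec ¬? (supported? c j v)) (c v))
  ... | yes unsupported = inj₂ unsupported
  ... | no none = inj₁ λ v j 1≤j j<cv →
    decidable-stable (supported? c j v) λ ¬supported → none (v , j , j<cv , 1≤j , ¬supported)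

  isGrundy? : ∀ c → Dec (IsGrundy G c)
  isGrundy? c with grundy⊎unsupported c
  ... | inj₁ grundy = yes grundy
  ... | inj₂ (v , j , j<cv , 1≤j , ¬supported) = no λ grundy → ¬supported (grundy v j 1≤j j<cv)

  IsGrundyPacking-resp-≗ : ∀ {c d m} → c ≗ d → IsGrundyPacking G c m → IsGrundyPacking G d m
  IsGrundyPacking-resp-≗ {c} {d} {m} c≗d ((bounds , onto) , packing , grundy) =
      ( (λ v → subst (λ x → 1 ≤ x × x ≤ m) (c≗d v) (bounds v))
      , λ j 1≤j j≤m → let (v , cv≡j) = onto j 1≤j j≤m in v , trans (≡-sym (c≗d v)) cv≡j )
    , (λ u v u≢v du≡dv → subst (λ x → ¬ DistLe G x u v) (c≗d v)
         (packing u v u≢v (trans (c≗d u) (trans du≡dv (≡-sym (c≗d v))))))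
    , λ v j 1≤j j<dv → let (u , cu≡j , dist) = grundy v j 1≤j (subst (j <_) (≡-sym (c≗d v)) j<dv) in
        u , trans (≡-sym (c≗d u)) cu≡j , dist

  grundyPacking? : ∀ m → Dec (GrundyPacking G m)
  grundyPacking? m = Dec.map′ (λ (xs , gp) → colouring xs , gp) (λ (_ , gp) → normalise gp)
    (anyVec? n λ xs → usesColors? (colouring xs) m ×-dec isPacking? (colouring xs)
                                                     ×-dec isGrundy? (colouring xs))
    where
    colouring : Vec (Fin m) n → Fin n → ℕ
    colouring xs v = suc (toℕ (lookup xs v))
    normalise : ∀ {c} → IsGrundyPacking G c m → ∃ λ xs → IsGrundyPacking G (colouring xs) m
    normalise {c} gp@((bounds , _) , _) = tabulate index , IsGrundyPacking-resp-≗ c≗colouring gp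
      where
      index : Fin n → Fin m
      index v = proj₁ (colourIndex (bounds v))
      c≗colouring : c ≗ colouring (tabulate index)
      c≗colouring v =
        ≡-sym (trans (cong (suc ∘ toℕ) (Vec.lookup∘tabulate index v)) (proj₂ (colourIndex (bounds v))))

∃-IsMax-bounded : ∀ {P : ℕ → Set} → Decidable P → ∀ B → (∀ m → P m → m ≤ B) → ∃ P → ∃ (IsMax P)
∃-IsMax-bounded P? zero bound (m , pm) with bound m pm
... | z≤n = 0 , pm , bound
∃-IsMax-bounded P? (suc B) bound witness with P? (suc B)
... | yes p  = suc B , p , bound
... | no ¬p  = ∃-IsMax-bounded P? B (λ m pm → ≤-pred (≤∧≢⇒< (bound m pm) λ { refl → ¬p pm })) witness

recolour : ∀ {n} → (Fin n → ℕ) → Fin n → ℕ → Fin n → ℕ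
recolour c v j = updateAt c v (const j)

recolour-view : ∀ {n} c (v : Fin n) j w → w ≡ v × recolour c v j w ≡ j ⊎ w ≢ v × recolour c v j w ≡ c w
recolour-view c v j w with w Fin.≟ v
... | yes refl = inj₁ (refl , updateAt-updates v c)
... | no w≢v   = inj₂ (w≢v , updateAt-minimal w v c w≢v)

recolour-pointwise : ∀ {n} (P : ℕ → Set) {c v j} → (∀ w → P (c w)) → P j → ∀ (w : Fin n) → P (recolour c v j w)
recolour-pointwise P {c} {v} {j} pc pj w with recolour-view c v j w
... | inj₁ (_ , eq) = subst P (≡-sym eq) pj
... | inj₂ (_ , eq) = subst P (≡-sym eq) (pc w)

sum-mono-≤ : ∀ {n} {f g : Fin n → ℕ} → (∀ i → f i ≤ g i) → sum f ≤ sum g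
sum-mono-≤ {zero}  _   = z≤n
sum-mono-≤ {suc n} f≤g = +-mono-≤ (f≤g Fin.zero) (sum-mono-≤ (f≤g ∘ Fin.suc))

sum-mono-< : ∀ {n} {f g : Fin n → ℕ} → (∀ i → f i ≤ g i) → ∀ i → f i < g i → sum f < sum g
sum-mono-< f≤g Fin.zero    lt = +-mono-<-≤ lt (sum-mono-≤ (f≤g ∘ Fin.suc))
sum-mono-< f≤g (Fin.suc i) lt = +-mono-≤-< (f≤g Fin.zero) (sum-mono-< (f≤g ∘ Fin.suc) i lt)

recolour-sum-< : ∀ {n} {c : Fin n → ℕ} {v j} → j < c v → sum (recolour c v j) < sum c
recolour-sum-< {c = c} {v} {j} j<cv =
  sum-mono-< decreases v (subst (_< c v) (≡-sym (updateAt-updates v c)) j<cv)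
  where
  decreases : ∀ w → recolour c v j w ≤ c w
  decreases w with recolour-view c v j w
  ... | inj₁ (refl , eq) = subst (_≤ c w) (≡-sym eq) (<⇒≤ j<cv)
  ... | inj₂ (_ , eq)    = ≤-reflexive eq

module _ {n : ℕ} (G : Graph n) where

  recolour-packing : ∀ {c v j} → IsPacking G c → (∀ u → u ≢ v → c u ≡ j → ¬ DistLe G j u v) →
                     IsPacking G (recolour c v j)
  recolour-packing {c} {v} {j} packing far u w u≢w
    with recolour c v j u | recolour-view c v j u | recolour c v j w | recolour-view c v j w
  ... | _ | inj₁ (refl , refl) | _ | inj₁ (refl , refl) = contradiction refl u≢w
  ... | _ | inj₁ (refl , refl) | _ | inj₂ (w≢v , refl) = λ j≡cw d →
    far w w≢v (≡-sym j≡cw) (DistLe-sym G (subst (λ i → DistLe G i u w) (≡-sym j≡cw) d))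
  ... | _ | inj₂ (u≢v , refl) | _ | inj₁ (refl , refl) = far u u≢v
  ... | _ | inj₂ (_ , refl)   | _ | inj₂ (_ , refl)   = packing u w u≢w

  maxColour⇒usesColors : ∀ {c m} v₀ → IsGrundy G c → (∀ v → 1 ≤ c v) → c v₀ ≡ m → (∀ v → c v ≤ m) →
                         UsesColors c m
  maxColour⇒usesColors {c} v₀ grundy positive refl ≤max = (λ v → positive v , ≤max v) , onto
    where
    onto : ∀ j → 1 ≤ j → j ≤ c v₀ → ∃ λ v → c v ≡ j
    onto j 1≤j j≤m with j ≟ c v₀
    ... | yes refl = v₀ , refl
    ... | no j≢m   = let (u , cu≡j , _) = grundy v₀ j 1≤j (≤∧≢⇒< j≤m j≢m) in u , cu≡j

  grundify : ∀ c → Acc (_<_ on sum {n}) c → (∀ v → 1 ≤ c v) → IsPacking G c →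
             ∃ λ c′ → (∀ v → 1 ≤ c′ v) × IsPacking G c′ × IsGrundy G c′
  grundify c (acc smaller) positive packing with grundy⊎unsupported G c
  ... | inj₁ grundy = c , positive , packing , grundy
  ... | inj₂ (v , j , j<cv , 1≤j , ¬supported) =
    grundify (recolour c v j) (smaller (recolour-sum-< {c = c} j<cv)) (recolour-pointwise (1 ≤_) positive 1≤j)
      (recolour-packing packing λ u _ cu≡j d → ¬supported (u , cu≡j , d))

grundyPacking-exists : ∀ {n} (G : Graph (suc n)) → ∃ (GrundyPacking G)
grundyPacking-exists {n} G
  with grundify G (suc ∘ toℕ) (On.wellFounded (sum {suc n}) <-wellFounded _) (λ _ → s≤s z≤n)
         (λ u v u≢v eq _ → u≢v (Fin.toℕ-injective (suc-injective eq)))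
... | c , positive , packing , grundy =
  c top , c , maxColour⇒usesColors G top grundy positive refl ≤top , packing , grundy
  where
  top : Fin (suc n)
  top = argmax c Fin.zero (allFin (suc n))
  ≤top : ∀ v → c v ≤ c top
  ≤top v = All.lookup (f[xs]≤f[argmax] {f = c} Fin.zero (allFin (suc n))) (∈-allFin v)

lookup-injective : ∀ {A : Set} {xs : List A} → Unique xs → Injective _≡_ _≡_ (List.lookup xs)
lookup-injective (_ ∷ _)      {Fin.zero}  {Fin.zero}  _  = refl
lookup-injective (x∉xs ∷ _)   {Fin.zero}  {Fin.suc j} eq = contradiction eq (All.lookup x∉xs (∈-lookup j))
lookup-injective (x∉xs ∷ _)   {Fin.suc i} {Fin.zero}  eq =
  contradiction (≡-sym eq) (All.lookup x∉xs (∈-lookup i))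
lookup-injective (_ ∷ unique) {Fin.suc i} {Fin.suc j} eq = cong Fin.suc (lookup-injective unique eq)

Unique-complete : ∀ {n} {xs : List (Fin n)} → Unique xs → length xs ≡ n → ∀ v → v ∈ xs
Unique-complete {n} {xs} unique length≡n v with Any.any? (v Fin.≟_) xs
... | yes v∈xs = v∈xs
... | no v∉xs  = contradiction
  (subst (λ l → suc l ≤ n) length≡n (Fin.injective⇒≤ (lookup-injective (All.¬Any⇒All¬ xs v∉xs ∷ unique))))
  (n≮n n)

Unique-map⁺ : ∀ {A B : Set} (f : A → B) {xs} → (∀ {x y} → x ∈ xs → y ∈ xs → f x ≡ f y → x ≡ y) →
              Unique xs → Unique (map f xs)
Unique-map⁺ f injective [] = []
Unique-map⁺ f injective (x∉xs ∷ unique) =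
  All.map⁺ (All.tabulate λ y∈xs fx≡fy →
    All.lookup x∉xs y∈xs (injective (Any.here refl) (Any.there y∈xs) fx≡fy))
  ∷ Unique-map⁺ f (λ x∈ y∈ → injective (Any.there x∈) (Any.there y∈)) unique

-- Colourings as vertex sets of G(k)

Encodes : ∀ {n} → VSet n → (Fin n → ℕ) → Set
Encodes A c = (∀ {v j} → (v , j) ∈ A → j ≡ c v) × (∀ v → (v , c v) ∈ A)

graphOf : ∀ {n} → (Fin n → ℕ) → VSet n
graphOf {n} c = map (λ v → v , c v) (allFin n)

∈-graphOf⁻ : ∀ {n} {c : Fin n → ℕ} {v j} → (v , j) ∈ graphOf c → j ≡ c v
∈-graphOf⁻ vj∈ with ∈-map⁻ _ vj∈
... | _ , _ , refl = refl

∈-graphOf⁺ : ∀ {n} (c : Fin n → ℕ) v → (v , c v) ∈ graphOf c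
∈-graphOf⁺ c v = ∈-map⁺ _ (∈-allFin v)

graphOf-encodes : ∀ {n} (c : Fin n → ℕ) → Encodes (graphOf c) c
graphOf-encodes c = ∈-graphOf⁻ , ∈-graphOf⁺ c

module _ {n : ℕ} (G : Graph n) where

  encodes⇒independent : ∀ {A c} → Encodes A c → IsPacking G c →
                        ∀ {p q} → p ∈ A → q ∈ A → p ≢ q → ¬ AdjGk G p q
  encodes⇒independent (level , _) _ p∈ q∈ _ (inj₁ (refl , i≢j)) = i≢j (trans (level p∈) (≡-sym (level q∈)))
  encodes⇒independent (level , _) packing {u , _} {v , _} p∈ q∈ _ (inj₂ (refl , u≢v , d)) =
    packing u v u≢v (trans (≡-sym (level p∈)) (level q∈)) (subst (λ x → DistLe G x u v) (level q∈) d)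

  maximalAt⇒supported : ∀ {A c j} → Encodes A c → MaximalAt G A j → ∀ v → j < c v → Supported G c j v
  maximalAt⇒supported (level , _) (_ , _ , maximal) v j<cv =
    let (u , uj∈ , _ , d) = maximal v (λ _ _ j′<j vj′∈ → <-irrefl (level vj′∈) (<-trans j′<j j<cv))
                                      (λ vj∈ → <-irrefl (level vj∈) j<cv)
    in u , ≡-sym (level uj∈) , d

  grundy⇒maximalAt : ∀ {A c i} → Encodes A c → (∀ v → 1 ≤ c v) → IsPacking G c → IsGrundy G c → 1 ≤ i →
                     MaximalAt G A i
  grundy⇒maximalAt {A} {c} {i} (level , mem) positive packing grundy 1≤i = inH , far , maximal
    where
    inH : ∀ u → (u , i) ∈ A → InH A i u
    inH u ui∈ j _ j<i uj∈ = <-irrefl (trans (level uj∈) (≡-sym (level ui∈))) j<i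
    far : ∀ u v → (u , i) ∈ A → (v , i) ∈ A → u ≢ v → ¬ DistLe G i u v
    far u v ui∈ vi∈ u≢v = subst (λ x → ¬ DistLe G x u v) (≡-sym (level vi∈))
      (packing u v u≢v (trans (≡-sym (level ui∈)) (level vi∈)))
    maximal : ∀ w → InH A i w → ¬ (w , i) ∈ A → ∃ λ u → (u , i) ∈ A × u ≢ w × DistLe G i u w
    maximal w w∈H wi∉A with <-cmp (c w) i
    ... | tri< cw<i _ _ = contradiction (mem w) (w∈H (c w) (positive w) cw<i)
    ... | tri≈ _ cw≡i _ = contradiction (subst (λ x → (w , x) ∈ A) cw≡i (mem w)) wi∉A
    ... | tri> _ _ i<cw = let (u , cu≡i , d) = grundy w i 1≤i i<cw in
      u , subst (λ x → (u , x) ∈ A) cu≡i (mem u)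
        , (λ u≡w → <-irrefl (≡-sym cu≡i) (subst (λ x → i < c x) (≡-sym u≡w) i<cw)) , d

module _ {n : ℕ} (G : Graph n) (k : ℕ) where

  EncodesPacking : VSet n → Set
  EncodesPacking A = ∃ λ c → Encodes A c × (∀ v → 1 ≤ c v × c v ≤ k) × IsPacking G c

  -- An independent n-set of G(k) meets each fibre {v^1, …, v^k} exactly once, by pigeonhole.
  indepOfSizeN⇒encodesPacking : ∀ {A} → IndepOfSizeN G k A → EncodesPacking A
  indepOfSizeN⇒encodesPacking {A} (unique , length≡n , levels , independent) =
    c , (level , mem) , (λ v → levels (mem v)) , packing
    where
    sameLevel : ∀ {v i j} → (v , i) ∈ A → (v , j) ∈ A → i ≡ j
    sameLevel {i = i} {j} vi∈ vj∈ = decidable-stable (i ≟ j) λ i≢j →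
      independent vi∈ vj∈ (i≢j ∘ cong proj₂) (inj₁ (refl , i≢j))
    occurs : ∀ v → v ∈ map proj₁ A
    occurs = Unique-complete
      (Unique-map⁺ proj₁ (λ { {v , _} p∈ q∈ refl → cong (v ,_) (sameLevel p∈ q∈) }) unique)
      (trans (length-map proj₁ A) length≡n)
    levelOf : ∀ v → ∃ λ i → (v , i) ∈ A
    levelOf v with ∈-map⁻ proj₁ (occurs v)
    ... | (_ , i) , vi∈ , refl = i , vi∈
    c : Fin n → ℕ
    c v = proj₁ (levelOf v)
    mem : ∀ v → (v , c v) ∈ A
    mem v = proj₂ (levelOf v)
    level : ∀ {v j} → (v , j) ∈ A → j ≡ c v
    level vj∈ = sameLevel vj∈ (mem _)
    packing : IsPacking G c
    packing u v u≢v cu≡cv d = independent (subst (λ i → (u , i) ∈ A) cu≡cv (mem u)) (mem v)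
      (u≢v ∘ cong proj₁) (inj₂ (refl , u≢v , d))

  dmpStep-encodesPacking : ∀ {A A′} → DMPStep G k A A′ → EncodesPacking A → EncodesPacking A′
  dmpStep-encodesPacking {A} {A′} (i , 1≤i , i<k , _ , _ , z , ℓ , zℓ∈A , _ , _ , _ , far , _ , members)
                                  (c , (level , mem) , bounds , packing) =
      recolour c z i , (level′ , mem′)
    , recolour-pointwise (λ x → 1 ≤ x × x ≤ k) bounds (1≤i , <⇒≤ i<k)
    , recolour-packing G packing λ u u≢z cu≡i → far u (subst (λ x → (u , x) ∈ A) cu≡i (mem u)) u≢z
    where
    level′ : ∀ {v j} → (v , j) ∈ A′ → j ≡ recolour c z i v
    level′ {v} {j} vj∈ with proj₁ (members (v , j)) vj∈ | recolour-view c z i v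
    ... | inj₁ (vj∈A , vj≢zℓ) | inj₁ (refl , _) =
      contradiction (cong (z ,_) (trans (level vj∈A) (≡-sym (level zℓ∈A)))) vj≢zℓ
    ... | inj₁ (vj∈A , _) | inj₂ (_ , eq)     = trans (level vj∈A) (≡-sym eq)
    ... | inj₂ refl       | inj₁ (_ , eq)     = ≡-sym eq
    ... | inj₂ refl       | inj₂ (z≢z , _)    = contradiction refl z≢z
    mem′ : ∀ v → (v , recolour c z i v) ∈ A′
    mem′ v with recolour c z i v | recolour-view c z i v
    ... | _ | inj₁ (refl , refl) = proj₂ (members (z , i)) (inj₂ refl)
    ... | _ | inj₂ (v≢z , refl)  = proj₂ (members (v , c v)) (inj₁ (mem v , v≢z ∘ cong proj₁))

  dmpRun-encodesPacking : ∀ {A B} → Star (DMPStep G k) A B → EncodesPacking A → EncodesPacking B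
  dmpRun-encodesPacking = Star.fold (λ A B → EncodesPacking A → EncodesPacking B)
                                    (λ step rest → rest ∘ dmpStep-encodesPacking step) id

module _ {n : ℕ} {G : Graph n} where

  dmpRunValue⇒grundyPacking : ∀ {k A m} → IndepOfSizeN G k A → DMPRunValue G k A m → GrundyPacking G m
  dmpRunValue⇒grundyPacking {k} indep (B , run , stop , (v₀ , v₀m∈B) , top)
    with dmpRun-encodesPacking G k run (indepOfSizeN⇒encodesPacking G k indep)
  ... | c , encodes@(level , mem) , bounds , packing =
      c , maxColour⇒usesColors G v₀ grundy (proj₁ ∘ bounds) (≡-sym (level v₀m∈B)) (λ v → top (mem v))
    , packing , grundy
    where
    grundy : IsGrundy G c
    grundy v j 1≤j j<cv =
      maximalAt⇒supported G encodes (stop j 1≤j (<-≤-trans j<cv (proj₂ (bounds v)))) v j<cv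

  graphOf-indepOfSizeN : ∀ {c m} → (∀ v → 1 ≤ c v × c v ≤ m) → IsPacking G c → IndepOfSizeN G m (graphOf c)
  graphOf-indepOfSizeN {c} {m} bounds packing =
      Unique.map⁺ (cong proj₁) (Unique.allFin⁺ n)
    , trans (length-map _ (allFin n)) (length-tabulate id)
    , (λ vi∈ → subst (λ x → 1 ≤ x × x ≤ m) (≡-sym (∈-graphOf⁻ vi∈)) (bounds _))
    , encodes⇒independent G (graphOf-encodes c) packing

  graphOf-dmpRunValue : ∀ {c m} → IsGrundyPacking G c m → 1 ≤ m → DMPRunValue G m (graphOf c) m
  graphOf-dmpRunValue {c} {m} ((bounds , onto) , packing , grundy) 1≤m with onto m 1≤m ≤-refl
  ... | top , ctop≡m =
      graphOf c , ε
    , (λ i 1≤i _ → grundy⇒maximalAt G (graphOf-encodes c) (proj₁ ∘ bounds) packing grundy 1≤i)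
    , (top , subst (λ x → (top , x) ∈ graphOf c) ctop≡m (∈-graphOf⁺ c top))
    , λ vi∈ → subst (_≤ m) (≡-sym (∈-graphOf⁻ vi∈)) (proj₂ (bounds _))

∃-maxGrundyPacking : ∀ {n} (G : Graph (suc n)) → ∃ (IsMax (GrundyPacking G))
∃-maxGrundyPacking {n} G = ∃-IsMax-bounded (grundyPacking? G) (suc n)
  (λ _ (_ , usesColors , _) → usesColors⇒≤ usesColors) (grundyPacking-exists G)

maxGrundyPacking⇒maxGreedyCount : ∀ {n} {G : Graph n} {Γ} →
                                  IsMax (GrundyPacking G) Γ → IsMax (GreedyCount G) Γ
maxGrundyPacking⇒maxGreedyCount {G = G} ((_ , gp) , Γ-max) =
  grundyPacking⇒greedyCount G gp , λ m → Γ-max m ∘ greedyCount⇒grundyPacking G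

maxGrundyPacking⇒maxDMPValue : ∀ {n} {G : Graph (suc n)} {Γ} →
                               IsMax (GrundyPacking G) Γ → IsMax (DMPValueOnI G) Γ
maxGrundyPacking⇒maxDMPValue {G = G} {Γ} ((c , gp@(usesColors , packing , _)) , Γ-max) =
    (Γ , 1≤Γ , usesColors⇒≤ usesColors , graphOf c , indep , graphOf-dmpRunValue gp 1≤Γ
    , λ m → Γ-max m ∘ dmpRunValue⇒grundyPacking indep)
  , λ { m (_ , _ , _ , _ , indep′ , run , _) → Γ-max m (dmpRunValue⇒grundyPacking indep′ run) }
  where
  1≤Γ : 1 ≤ Γ
  1≤Γ = uncurry ≤-trans (proj₁ usesColors Fin.zero)
  indep : IndepOfSizeN G Γ (graphOf c)
  indep = graphOf-indepOfSizeN (proj₁ usesColors) packing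

theorem4 : (n : ℕ) (G : Graph (suc n)) →
    ∃ λ m → IsMax (GreedyCount G) m × IsMax (DMPValueOnI G) m
theorem4 n G =
  let (Γ , Γ-max) = ∃-maxGrundyPacking G in
  Γ , maxGrundyPacking⇒maxGreedyCount Γ-max , maxGrundyPacking⇒maxDMPValue Γ-max
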